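{- Let $G$ be an ADB-AC graph with a planar annular embedding having $x\ge 3$ annuli, and let $F^1(O_G)$, $F^2(O_G)$ be the two alternating classes of faces of its outer annulus $O_G$. Then either $F^1(O_G)$ or $F^2(O_G)$ consists only of $4$-cycles.
   Context: A Barnette graph is a finite $3$-regular, $3$-connected, planar, bipartite graph. A Barnette graph $G$ is an $x$-ADB graph if it has a plane embedding (a planar annular embedding) with pairwise vertex-disjoint cycles $C_0,C_1,\dots,C_x$ of $G$, each $C_{k-1}$ lying in the bounded region of $C_k$, such that $C_0$ bounds a face, $C_x$ bounds the unbounded face, every vertex lies on some $C_k$, and every edge is either an edge of some $C_k$ or joins a vertex of $C_{k-1}$ to a vertex of $C_k$ for some $1\le k\le x$. The closed region between $C_{k-1}$ and $C_k$ is the $k$-th annulus $A_k$; edges joining $C_{k-1}$ to $C_k$ lie in its interior; the faces of $G$ inside $A_k$ are the faces of $A_k$; $O_G=A_x$ is the outer annulus. Suppressing degree-$2$ vertices means replacing each maximal path whose internal vertices have degree $2$ by a single edge (a cycle all of whose vertices have degree $2$ becomes a vertex-less closed curve). An $x$-ADB graph with $x>2$ is annular connected (ADB-AC) if for every $k$, deleting the edges in the interior of $A_k$ and suppressing degree-$2$ vertices yields either two Barnette graphs or a Barnette graph and a vertex-less closed curve. The faces of the outer annulus are cyclically arranged, consecutive ones sharing an edge in the interior of the annulus; there is an even number of them, so they split into two classes $F^1(O_G)$, $F^2(O_G)$, each consisting of pairwise non-adjacent (alternating) faces. -}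

module Defs where

open import Data.Nat using (ℕ; zero; suc; _+_; _∸_; _≤_; _<ᵇ_; _≤ᵇ_)
open import Data.Nat.DivMod using (_%_; m%n<n)
import Data.Fin as Fin
import Data.Nat as N
open import Data.Fin using (Fin; toℕ; fromℕ<; inject₁; fromℕ) renaming (_<_ to _<F_)
open import Data.Fin.Properties using (_≟_)
open import Data.Bool using (Bool; true; false; T; _∧_; _∨_; not; if_then_else_)
open import Data.Product using (Σ; _×_; _,_; proj₁; proj₂; swap)
open import Data.Sum using (_⊎_; inj₁; inj₂)
open import Data.Empty using (⊥)
open import Data.Unit using (tt)
open import Relation.Binary.PropositionalEquality using (_≡_; _≢_; refl)
open import Relation.Nullary using (¬_; yes; no)
open import Relation.Nullary.Decidable using (⌊_⌋)
open import Function using (_∘_)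
open import Function.Bundles using (_↔_)
open import Function.Definitions using (Injective)

allB : ∀ {n} → (Fin n → Bool) → Bool
allB {zero}  p = true
allB {suc n} p = p Fin.zero ∧ allB (λ i → p (Fin.suc i))

anyB : ∀ {n} → (Fin n → Bool) → Bool
anyB {zero}  p = false
anyB {suc n} p = p Fin.zero ∨ anyB (λ i → p (Fin.suc i))

T-∧₁ : ∀ a b → T (a ∧ b) → T a
T-∧₁ true b _ = tt

T-∧₂ : ∀ a b → T (a ∧ b) → T b
T-∧₂ true b p = p

-- Cyclic arithmetic on Fin n (positions on a cycle of length n,
-- numbered counterclockwise)

shift : ∀ {n} → Fin n → ℕ → Fin n
shift {suc n} j t = fromℕ< (m%n<n (toℕ j + t) (suc n))

-- number of counterclockwise steps from j to j' (in 1..n; a full turn if j = j')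
cdist : ∀ {n} → Fin n → Fin n → ℕ
cdist {suc n} j j' =
  if ⌊ j ≟ j' ⌋ then suc n else (toℕ j' + suc n ∸ toℕ j) % suc n

Cyc : ∀ {n} → Fin n → Fin n → Fin n → Set
Cyc a b c = (a <F b × b <F c) ⊎ (b <F c × c <F a) ⊎ (c <F a × a <F b)

record Graph : Set₁ where
  field
    V    : Set
    E    : Set
    ends : E → V × V

module _ (G : Graph) where
  open Graph G

  Loopless : Set
  Loopless = ∀ e → proj₁ (ends e) ≢ proj₂ (ends e)

  NoParallel : Set
  NoParallel = ∀ e e' → (ends e ≡ ends e' ⊎ ends e ≡ swap (ends e')) → e ≡ e'

  Simple : Set
  Simple = Loopless × NoParallel

  -- half-edges at v (degree = their number)
  Incident : V → Set
  Incident v = Σ E (λ e → proj₁ (ends e) ≡ v) ⊎ Σ E (λ e → proj₂ (ends e) ≡ v)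

  Cubic : Set
  Cubic = ∀ v → Incident v ↔ Fin 3

  Bipartite : Set
  Bipartite = Σ (V → Bool) λ c → ∀ e → c (proj₁ (ends e)) ≢ c (proj₂ (ends e))

  data WalkAvoiding (S : V → Set) : V → V → Set where
    here : ∀ {u} → WalkAvoiding S u u
    step : ∀ {u v w} (e : E) → (ends e ≡ (u , v) ⊎ ends e ≡ (v , u)) →
           ¬ S v → WalkAvoiding S v w → WalkAvoiding S u w

  -- at least 4 vertices, and deleting at most two vertices leaves it connected
  ThreeConnected : Set
  ThreeConnected =
    Σ (Fin 4 → V) (Injective _≡_ _≡_) ×
    (∀ a b u w → u ≢ a → u ≢ b → w ≢ a → w ≢ b →
       WalkAvoiding (λ v → v ≡ a ⊎ v ≡ b) u w)

  -- Barnette graph (planarity is witnessed separately by the annular data)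
  Barnette : Set
  Barnette = Simple × Cubic × ThreeConnected × Bipartite

-- Cycles C_0 … C_x (index k : Fin (suc x)), C_k has vertices Fin (len k) in
-- counterclockwise order; annulus A_{a+1} (a : Fin x) lies between C_a (= inject₁ a)
-- and C_{a+1} (= suc a); its edges ("spokes") are numbered by Fin (nsp a)
-- counterclockwise (strictly increasing inner endpoint) and do not cross.

record ADB (x : ℕ) : Set where
  field
    len      : Fin (suc x) → ℕ
    len≥3    : ∀ k → 3 ≤ len k
    nsp      : Fin x → ℕ
    sin      : (a : Fin x) → Fin (nsp a) → Fin (len (inject₁ a))
    sout     : (a : Fin x) → Fin (nsp a) → Fin (len (Fin.suc a))
    sin-mono : ∀ a i j → i <F j → sin a i <F sin a j
    sout-inj : ∀ a i j → sout a i ≡ sout a j → i ≡ j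
    noncross : ∀ a i j l → Cyc i j l → Cyc (sout a i) (sout a j) (sout a l)

module ADBGraph {x : ℕ} (D : ADB x) where
  open ADB D
  import Data.Fin as F

  Vtx : Set
  Vtx = Σ (Fin (suc x)) (λ k → Fin (len k))

  level : Vtx → Fin (suc x)
  level = proj₁

  data Ed : Set where
    cyc : (k : Fin (suc x)) → Fin (len k) → Ed
    spk : (a : Fin x) → Fin (nsp a) → Ed

  edEnds : Ed → Vtx × Vtx
  edEnds (cyc k j) = (k , j) , (k , shift j 1)
  edEnds (spk a i) = (inject₁ a , sin a i) , (F.suc a , sout a i)

  graph : Graph
  graph = record { V = Vtx ; E = Ed ; ends = edEnds }

  isInnerEnd : Fin x → Vtx → Bool
  isInnerEnd a (k , j) with k ≟ inject₁ a
  ... | yes refl = anyB (λ i → ⌊ sin a i ≟ j ⌋)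
  ... | no _ = false

  isOuterEnd : Fin x → Vtx → Bool
  isOuterEnd a (k , j) with k ≟ F.suc a
  ... | yes refl = anyB (λ i → ⌊ sout a i ≟ j ⌋)
  ... | no _ = false

  isCycEdgeOf : Fin (suc x) → Ed → Bool
  isCycEdgeOf c (cyc k j) = ⌊ k ≟ c ⌋
  isCycEdgeOf c (spk a i) = false

  -- The piece obtained by keeping the vertices satisfying `kept` (one side of the
  -- deleted annulus, minus the degree-2 vertices on the boundary cycle C_c) and
  -- suppressing the degree-2 vertices of C_c: edges of G between kept vertices other
  -- than edges of C_c, plus one edge for each maximal path of C_c between
  -- counterclockwise-consecutive kept vertices j, j' of C_c (a loop if j = j').
  module Piece (c : Fin (suc x)) (kept : Vtx → Bool) where

    keepEd : Ed → Bool
    keepEd e = not (isCycEdgeOf c e) ∧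
               (kept (proj₁ (edEnds e)) ∧ kept (proj₂ (edEnds e)))

    noneKeptBetween : Fin (len c) → Fin (len c) → Bool
    noneKeptBetween j j' =
      allB {len c} (λ t → not ((1 ≤ᵇ toℕ t) ∧ (toℕ t <ᵇ cdist j j'))
                  ∨ not (kept (c , shift j (toℕ t))))

    segOK : Fin (len c) → Fin (len c) → Bool
    segOK j j' = kept (c , j) ∧ (kept (c , j') ∧ noneKeptBetween j j')

    PV : Set
    PV = Σ Vtx (T ∘ kept)

    PE : Set
    PE = Σ Ed (T ∘ keepEd) ⊎ Σ (Fin (len c) × Fin (len c)) (λ p → T (segOK (proj₁ p) (proj₂ p)))

    pends : PE → PV × PV
    pends (inj₁ (e , p)) =
      (u , T-∧₁ (kept u) (kept w) q) , (w , T-∧₂ (kept u) (kept w) q)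
      where
        u = proj₁ (edEnds e)
        w = proj₂ (edEnds e)
        q = T-∧₂ (not (isCycEdgeOf c e)) (kept u ∧ kept w) p
    pends (inj₂ ((j , j') , p)) =
      ((c , j) , T-∧₁ (kept (c , j)) _ p) ,
      ((c , j') , T-∧₁ (kept (c , j')) (noneKeptBetween j j')
                   (T-∧₂ (kept (c , j)) _ p))

    piece : Graph
    piece = record { V = PV ; E = PE ; ends = pends }

    -- every vertex of C_c is suppressed: C_c becomes a vertex-less closed curve
    curveLeft : Bool
    curveLeft = allB (λ j → not (kept (c , j)))

    IsBarnettePiece : Set
    IsBarnettePiece = Barnette piece × T (not curveLeft)

    IsClosedCurve : Set
    IsClosedCurve = (PV → ⊥) × T curveLeft

  -- deleting the edges interior to A_{a+1}: the inner side (C_0 … C_a) and outer side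
  -- (C_{a+1} … C_x); the vertices that become degree 2 are the spoke endpoints.
  keptIn : Fin x → Vtx → Bool
  keptIn a v = (toℕ (level v) ≤ᵇ toℕ a) ∧ not (isInnerEnd a v)

  keptOut : Fin x → Vtx → Bool
  keptOut a v = (suc (toℕ a) ≤ᵇ toℕ (level v)) ∧ not (isOuterEnd a v)

  InnerBarnette InnerCurve OuterBarnette OuterCurve : Fin x → Set
  InnerBarnette a = Piece.IsBarnettePiece (inject₁ a) (keptIn a)
  InnerCurve    a = Piece.IsClosedCurve   (inject₁ a) (keptIn a)
  OuterBarnette a = Piece.IsBarnettePiece (F.suc a) (keptOut a)
  OuterCurve    a = Piece.IsClosedCurve   (F.suc a) (keptOut a)

  AnnularConnected : Set
  AnnularConnected = ∀ a →
    (InnerBarnette a × OuterBarnette a) ⊎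
    (InnerBarnette a × OuterCurve a) ⊎
    (InnerCurve a × OuterBarnette a)

  IsADBAC : Set
  IsADBAC = 2 N.< x × Barnette graph × AnnularConnected

  -- face i of annulus A_{a+1}: between spokes i and i+1 (cyclically); its boundary
  -- length is 2 + (inner arc) + (outer arc)
  faceLength : (a : Fin x) → Fin (nsp a) → ℕ
  faceLength a i =
    2 + cdist (sin a i) (sin a (shift i 1)) + cdist (sout a i) (sout a (shift i 1))

  -- the two alternating classes of faces of annulus A_{a+1}: F¹ = even-indexed,
  -- F² = odd-indexed faces
  InClass : (a : Fin x) → Fin (nsp a) → ℕ → Set
  InClass a i r = toℕ i % 2 ≡ r

  ClassAllFourCycles : Fin x → ℕ → Set
  ClassAllFourCycles a r = ∀ i → InClass a i r → faceLength a i ≡ 4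

-- the outer annulus O_G = A_x
outerAnnulus : ∀ {x} → 3 ≤ x → Fin x
outerAnnulus {suc y} _ = fromℕ y

-- Every vertex of the outer cycle C_x has degree 3, so it is the outer end of a spoke of O_G; as
-- spokes do not cross, consecutive spokes have consecutive outer ends, and a face of O_G is a
-- 4-cycle exactly when its arc on C_{x-1} is a single edge.  Deleting the spokes of O_G leaves C_x
-- as a closed curve, so annular connectivity makes the inner piece a Barnette graph, hence
-- bipartite.  Its colouring differs from that of G by a constant on C_{x-2}, hence (through the
-- spokes of A_{x-1}) on the surviving vertices of C_{x-1}; so every maximal run of spoke ends on
-- C_{x-1}, which is suppressed into one edge of the inner piece, has even length.  Counting spoke
-- ends along C_{x-1} then shows that all faces of O_G that are not 4-cycles have indices of the
-- same parity (the number of spokes being even as G is bipartite).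
module Submission where

open import Defs
open import Data.Bool using (Bool; true; false; not; _xor_; _∧_; _∨_; if_then_else_; T)
open import Data.Bool.Properties
  using (T-≡; T-∨; T-∧; T-irrelevant; not-injective; not-involutive; not-distribˡ-xor;
         not-distribʳ-xor; xor-identityʳ; ¬-not)
open import Data.Bool.Solver using (module xor-∧-Solver)
open import Data.Empty using (⊥-elim)
open import Data.Fin as F using (Fin; toℕ; fromℕ; fromℕ<; inject₁) renaming (_<_ to _<F_)
import Data.Fin.Properties as FP
open import Data.Fin.Induction using (<-weakInduction)
open import Data.Fin.Relation.Unary.Top using (view; ‵fromℕ; ‵inject₁)
import Data.Nat as N
open import Data.Nat
  using (ℕ; zero; suc; _+_; _∸_; _<_; _≤_; _≤ᵇ_; _<ᵇ_; _≤′_; ≤′-refl; ≤′-step; s≤s; z≤n; s<s)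
open import Data.Nat.DivMod using (_%_; m<n⇒m%n≡m; n%n≡0; [m+n]%n≡m%n)
open import Data.Nat.Induction using (<-rec)
import Data.Nat.Properties as NP
open import Data.Product using (_×_; _,_; proj₁; proj₂; ∃)
open import Data.Product.Properties using (≡-dec)
open import Data.Product.Properties.WithK using (,-injectiveʳ)
open import Data.Sum as Sum using (_⊎_; inj₁; inj₂)
open import Data.Unit using (tt)
open import Function using (_∘_)
open import Function.Bundles using (Equivalence; Injection; _⇔_; mk⇔)
open import Function.Definitions using (Injective)
open import Function.Properties.Inverse using (↔-sym; ↔⇒↣)
open import Relation.Binary using (tri<; tri≈; tri>; _Preserves_⟶_)
open import Relation.Binary.PropositionalEquality
open import Relation.Nullary using (¬_; contradiction; yes; no)
open import Relation.Nullary.Decidable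
  using (_⊎-dec_; toWitness; fromWitness; fromWitnessFalse; ⌊_⌋; decidable-stable; ¬?)
open import Relation.Unary using (Decidable)

open ≡-Reasoning
open xor-∧-Solver using (solve; _:+_; _:=_; con)

isOdd : ℕ → Bool
isOdd zero    = false
isOdd (suc n) = not (isOdd n)

isOdd-+ : ∀ m n → isOdd (m + n) ≡ isOdd m xor isOdd n
isOdd-+ zero    n = refl
isOdd-+ (suc m) n = trans (cong not (isOdd-+ m n)) (not-distribˡ-xor (isOdd m) (isOdd n))

n%2≡if-isOdd : ∀ n → n % 2 ≡ (if isOdd n then 1 else 0)
n%2≡if-isOdd 0 = refl
n%2≡if-isOdd 1 = refl
n%2≡if-isOdd (suc (suc n)) = begin
  (2 + n) % 2                              ≡⟨ cong (_% 2) (NP.+-comm 2 n) ⟩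
  (n + 2) % 2                              ≡⟨ [m+n]%n≡m%n n 2 ⟩
  n % 2                                    ≡⟨ n%2≡if-isOdd n ⟩
  (if isOdd n then 1 else 0)               ≡˘⟨ cong (λ b → if b then 1 else 0) (not-involutive (isOdd n)) ⟩
  (if not (not (isOdd n)) then 1 else 0)   ∎

≢⇒xor≡true : ∀ {a b} → a ≢ b → a xor b ≡ true
≢⇒xor≡true {true}  {true}  a≢b = contradiction refl a≢b
≢⇒xor≡true {true}  {false} _   = refl
≢⇒xor≡true {false} {true}  _   = refl
≢⇒xor≡true {false} {false} a≢b = contradiction refl a≢b

≢-xor-≢ : ∀ {a b c d} → a ≢ b → c ≢ d → a xor c ≡ b xor d
≢-xor-≢ {a} {b} {c} {d} a≢b c≢d = begin
  a xor c           ≡⟨ cong₂ _xor_ (¬-not a≢b) (¬-not c≢d) ⟩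
  not b xor not d   ≡⟨ solve 2 (λ b d → (con true :+ b) :+ (con true :+ d) := b :+ d) refl b d ⟩
  b xor d           ∎

xor-exchange : ∀ a b c d → a xor b ≡ c xor d → a xor c ≡ b xor d
xor-exchange a b c d e = begin
  a xor c                   ≡⟨ solve 3 (λ a b c → a :+ c := (a :+ b) :+ (b :+ c)) refl a b c ⟩
  (a xor b) xor (b xor c)   ≡⟨ cong (_xor (b xor c)) e ⟩
  (c xor d) xor (b xor c)   ≡⟨ solve 3 (λ b c d → (c :+ d) :+ (b :+ c) := b :+ d) refl b c d ⟩
  b xor d                   ∎

≢-≢⇒≡ : ∀ {a b c : Bool} → a ≢ b → b ≢ c → a ≡ c
≢-≢⇒≡ a≢b b≢c = trans (¬-not a≢b) (sym (¬-not (b≢c ∘ sym)))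

¬T⇒T-not : ∀ {b} → ¬ T b → T (not b)
¬T⇒T-not {false} _  = tt
¬T⇒T-not {true}  ¬t = ¬t tt

T-not⇒¬T : ∀ {b} → T (not b) → ¬ T b
T-not⇒¬T {false} _ ()

T-not-∧-not : ∀ x {y} → T y → T (not (x ∧ not y))
T-not-∧-not true  {true} _ = tt
T-not-∧-not false        _ = tt

anyB-intro : ∀ {n} {p : Fin n → Bool} i → T (p i) → T (anyB p)
anyB-intro F.zero    t = Equivalence.from T-∨ (inj₁ t)
anyB-intro (F.suc i) t = Equivalence.from T-∨ (inj₂ (anyB-intro i t))

anyB-elim : ∀ {n} {p : Fin n → Bool} → T (anyB p) → ∃ λ i → T (p i)
anyB-elim {suc n} t with Equivalence.to T-∨ t
... | inj₁ t₀ = F.zero , t₀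
... | inj₂ t′ = let i , tᵢ = anyB-elim t′ in F.suc i , tᵢ

allB-intro : ∀ {n} {p : Fin n → Bool} → (∀ i → T (p i)) → T (allB p)
allB-intro {zero}  all = tt
allB-intro {suc n} all = Equivalence.from T-∧ (all F.zero , allB-intro (all ∘ F.suc))

toℕ-shift : ∀ {n} (j : Fin n) t → toℕ j + t < n → toℕ (shift j t) ≡ toℕ j + t
toℕ-shift {suc n} j t lt = trans (FP.toℕ-fromℕ< _) (m<n⇒m%n≡m lt)

shift-inject₁ : ∀ {n} (i : Fin n) → shift (inject₁ i) 1 ≡ F.suc i
shift-inject₁ {n} i = FP.toℕ-injective (begin
  toℕ (shift (inject₁ i) 1)   ≡⟨ toℕ-shift (inject₁ i) 1 (subst (_< suc n) (sym next) (s<s (FP.toℕ<n i))) ⟩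
  toℕ (inject₁ i) + 1         ≡⟨ next ⟩
  suc (toℕ i)                 ∎)
  where
  next : toℕ (inject₁ i) + 1 ≡ suc (toℕ i)
  next = trans (NP.+-comm _ 1) (cong suc (FP.toℕ-inject₁ i))

shift-fromℕ : ∀ n → shift (fromℕ n) 1 ≡ F.zero
shift-fromℕ n = FP.toℕ-injective (begin
  toℕ (shift (fromℕ n) 1)       ≡⟨ FP.toℕ-fromℕ< _ ⟩
  (toℕ (fromℕ n) + 1) % suc n   ≡⟨ cong (λ k → (k + 1) % suc n) (FP.toℕ-fromℕ n) ⟩
  (n + 1) % suc n               ≡⟨ cong (_% suc n) (NP.+-comm n 1) ⟩
  suc n % suc n                 ≡⟨ n%n≡0 (suc n) ⟩
  0                             ∎)

inject₁<suc : ∀ {n} (i : Fin n) → inject₁ i <F F.suc i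
inject₁<suc i = FP.≤̄⇒inject₁< FP.≤-refl

shift1-cases : ∀ {n} (j : Fin n) →
  (suc (toℕ j) < n × toℕ (shift j 1) ≡ suc (toℕ j)) ⊎ (suc (toℕ j) ≡ n × toℕ (shift j 1) ≡ 0)
shift1-cases {n} j with view j
... | ‵inject₁ i = inj₁ (subst (_< n) (cong suc (sym (FP.toℕ-inject₁ i))) (s<s (FP.toℕ<n i))
                       , trans (cong toℕ (shift-inject₁ i)) (cong suc (sym (FP.toℕ-inject₁ i))))
... | ‵fromℕ {n = n} = inj₂ (cong suc (FP.toℕ-fromℕ n) , cong toℕ (shift-fromℕ n))

shift1-injective : ∀ {n} {i j : Fin n} → shift i 1 ≡ shift j 1 → i ≡ j
shift1-injective {i = i} {j} eq with view i | view j
... | ‵inject₁ i′ | ‵inject₁ j′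
  rewrite shift-inject₁ i′ | shift-inject₁ j′ = cong inject₁ (FP.suc-injective eq)
... | ‵inject₁ i′ | ‵fromℕ     with () ← trans (sym (shift-inject₁ i′)) (trans eq (shift-fromℕ _))
... | ‵fromℕ     | ‵inject₁ j′ with () ← trans (sym (shift-fromℕ _)) (trans eq (shift-inject₁ j′))
... | ‵fromℕ     | ‵fromℕ     = refl

shift1≢ : ∀ {n} → 2 ≤ n → (j : Fin n) → shift j 1 ≢ j
shift1≢ _ j eq with view j
... | ‵inject₁ i = FP.<-irrefl (sym (trans (sym (shift-inject₁ i)) eq)) (inject₁<suc i)
shift1≢ (s≤s (s≤s z≤n)) .(fromℕ (suc n)) eq | ‵fromℕ {n = suc n}
  with () ← trans (sym (shift-fromℕ (suc n))) eq

cdist-< : ∀ {n} (j j′ : Fin n) → j <F j′ → cdist j j′ ≡ toℕ j′ ∸ toℕ j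
cdist-< {suc n} j j′ j<j′ with j FP.≟ j′
... | yes refl = contradiction j<j′ (NP.<-irrefl refl)
... | no _ = begin
  (toℕ j′ + suc n ∸ toℕ j) % suc n   ≡⟨ cong (_% suc n) (NP.+-∸-comm (suc n) (NP.<⇒≤ j<j′)) ⟩
  (toℕ j′ ∸ toℕ j + suc n) % suc n   ≡⟨ [m+n]%n≡m%n (toℕ j′ ∸ toℕ j) (suc n) ⟩
  (toℕ j′ ∸ toℕ j) % suc n           ≡⟨ m<n⇒m%n≡m (NP.≤-<-trans (NP.m∸n≤m (toℕ j′) (toℕ j))
                                                                (FP.toℕ<n j′)) ⟩
  toℕ j′ ∸ toℕ j                     ∎

cdist-shift1 : ∀ {n} → 2 ≤ n → (j : Fin n) → cdist j (shift j 1) ≡ 1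
cdist-shift1 _ j with view j
... | ‵inject₁ i rewrite shift-inject₁ i = begin
  cdist (inject₁ i) (F.suc i)      ≡⟨ cdist-< (inject₁ i) (F.suc i) (inject₁<suc i) ⟩
  suc (toℕ i) ∸ toℕ (inject₁ i)    ≡⟨ cong (suc (toℕ i) ∸_) (FP.toℕ-inject₁ i) ⟩
  suc (toℕ i) ∸ toℕ i              ≡⟨ NP.m+n∸n≡m 1 (toℕ i) ⟩
  1                                ∎
cdist-shift1 (s≤s (s≤s z≤n)) .(fromℕ (suc n)) | ‵fromℕ {n = suc n} rewrite shift-fromℕ (suc n) =
  trans (cong (λ k → (suc n ∸ k) % suc (suc n)) (FP.toℕ-fromℕ n))
        (cong (_% suc (suc n)) (NP.m+n∸n≡m 1 n))

Cyc-shift1 : ∀ {n} (i k : Fin n) → k ≢ i → k ≢ shift i 1 → Cyc i (shift i 1) k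
Cyc-shift1 i k k≢i k≢i⁺ with view i
... | ‵inject₁ i′ rewrite shift-inject₁ i′ with FP.<-cmp k (F.suc i′)
...   | tri< k<i⁺ _ _ = inj₂ (inj₂ (k<i , inject₁<suc i′))
  where
  k<i : k <F inject₁ i′
  k<i = FP.≤∧≢⇒< (subst (toℕ k ≤_) (sym (FP.toℕ-inject₁ i′)) (NP.m<1+n⇒m≤n k<i⁺)) k≢i
...   | tri≈ _ k≡i⁺ _ = contradiction k≡i⁺ k≢i⁺
...   | tri> _ _ i⁺<k = inj₁ (inject₁<suc i′ , i⁺<k)
Cyc-shift1 .(fromℕ n) k k≢i k≢i⁺ | ‵fromℕ {n = n} =
  subst (λ i⁺ → Cyc (fromℕ n) i⁺ k) (sym (shift-fromℕ n))
    (inj₂ (inj₁ ( FP.≤∧≢⇒< z≤n (λ 0≡k → k≢i⁺ (trans (sym 0≡k) (sym (shift-fromℕ n))))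
                , FP.≤∧≢⇒< (FP.≤fromℕ k) k≢i)))

¬Cyc-shift1 : ∀ {n} (i k : Fin n) → ¬ Cyc i k (shift i 1)
¬Cyc-shift1 i k cyc with view i
... | ‵inject₁ i′ rewrite shift-inject₁ i′ with cyc
...   | inj₁ (i<k , k<i⁺) =
  NP.<⇒≱ i<k (subst (toℕ k ≤_) (sym (FP.toℕ-inject₁ i′)) (NP.m<1+n⇒m≤n k<i⁺))
...   | inj₂ (inj₁ (_ , i⁺<i)) = FP.<-asym i⁺<i (inject₁<suc i′)
...   | inj₂ (inj₂ (i⁺<i , _)) = FP.<-asym i⁺<i (inject₁<suc i′)
¬Cyc-shift1 .(fromℕ n) k cyc | ‵fromℕ {n = n} with subst (Cyc (fromℕ n) k) (shift-fromℕ n) cyc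
...   | inj₁ (last<k , _)        = NP.<⇒≱ last<k (FP.≤fromℕ k)
...   | inj₂ (inj₂ (_ , last<k)) = NP.<⇒≱ last<k (FP.≤fromℕ k)

successor-preserved : ∀ {m n} (g : Fin m → Fin n) → (∀ {i j k} → Cyc i j k → Cyc (g i) (g j) (g k)) →
                      ∀ {i j} → g j ≡ shift (g i) 1 → g j ≢ g i → g (shift i 1) ≡ shift (g i) 1
successor-preserved g g-cyc {i} {j} gj≡gi⁺ gj≢gi with j FP.≟ shift i 1
... | yes refl = gj≡gi⁺
... | no j≢i⁺ =
  contradiction (subst (Cyc (g i) (g (shift i 1))) gj≡gi⁺ (g-cyc (Cyc-shift1 i j (gj≢gi ∘ cong g) j≢i⁺)))
                (¬Cyc-shift1 (g i) (g (shift i 1)))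

Alternating : ∀ {n} → (Fin n → Bool) → Set
Alternating h = ∀ j → h (shift j 1) ≢ h j

alternating-fromZero : ∀ {n} {h : Fin (suc n) → Bool} → Alternating h →
                       ∀ i → h i ≡ h F.zero xor isOdd (toℕ i)
alternating-fromZero {h = h} alt =
  <-weakInduction (λ i → h i ≡ h F.zero xor isOdd (toℕ i)) (sym (xor-identityʳ (h F.zero))) extend
  where
  extend : ∀ i → h (inject₁ i) ≡ h F.zero xor isOdd (toℕ (inject₁ i)) →
           h (F.suc i) ≡ h F.zero xor isOdd (toℕ (F.suc i))
  extend i hyp = begin
    h (F.suc i)                                   ≡˘⟨ cong h (shift-inject₁ i) ⟩
    h (shift (inject₁ i) 1)                       ≡⟨ ¬-not (alt (inject₁ i)) ⟩
    not (h (inject₁ i))                           ≡⟨ cong not hyp ⟩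
    not (h F.zero xor isOdd (toℕ (inject₁ i)))    ≡⟨ not-distribʳ-xor (h F.zero) _ ⟩
    h F.zero xor not (isOdd (toℕ (inject₁ i)))    ≡⟨ cong (λ t → h F.zero xor not (isOdd t))
                                                          (FP.toℕ-inject₁ i) ⟩
    h F.zero xor not (isOdd (toℕ i))              ∎

alternating⇒xor≡isOdd : ∀ {n} {h : Fin n → Bool} → Alternating h →
                        ∀ i j → h i xor h j ≡ isOdd (toℕ i) xor isOdd (toℕ j)
alternating⇒xor≡isOdd {suc n} {h} alt i j = begin
  h i xor h j
    ≡⟨ cong₂ _xor_ (alternating-fromZero alt i) (alternating-fromZero alt j) ⟩
  (h F.zero xor isOdd (toℕ i)) xor (h F.zero xor isOdd (toℕ j))
    ≡⟨ solve 3 (λ z p q → (z :+ p) :+ (z :+ q) := p :+ q) refl (h F.zero) _ _ ⟩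
  isOdd (toℕ i) xor isOdd (toℕ j)
    ∎

alternating⇒even : ∀ {n} {h : Fin n → Bool} → Alternating h → isOdd n ≡ false
alternating⇒even {zero}  alt = refl
alternating⇒even {suc n} {h} alt = cong not (begin
  isOdd n                    ≡˘⟨ cong isOdd (FP.toℕ-fromℕ n) ⟩
  isOdd (toℕ (fromℕ n))      ≡˘⟨ alternating⇒xor≡isOdd alt F.zero (fromℕ n) ⟩
  h F.zero xor h (fromℕ n)   ≡⟨ ≢⇒xor≡true (subst (λ j → h j ≢ h (fromℕ n)) (shift-fromℕ n)
                                                   (alt (fromℕ n))) ⟩
  true                       ∎)

-- Positions 0 … m-1 of a cycle, those hit by f being its ends and the others kept.
module EndCount {m s : ℕ} (f : Fin s → Fin m) where

  IsEnd : ℕ → Set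
  IsEnd t = ∃ λ i → toℕ (f i) ≡ t

  isEnd? : Decidable IsEnd
  isEnd? t = FP.any? λ i → toℕ (f i) N.≟ t

  endsBelow : ℕ → ℕ
  endsBelow zero = 0
  endsBelow (suc t) with isEnd? t
  ... | yes _ = suc (endsBelow t)
  ... | no _  = endsBelow t

  endsBelow-end : ∀ {t} → IsEnd t → endsBelow (suc t) ≡ suc (endsBelow t)
  endsBelow-end {t} e with isEnd? t
  ... | yes _ = refl
  ... | no ¬e = contradiction e ¬e

  endsBelow-kept : ∀ {t} → ¬ IsEnd t → endsBelow (suc t) ≡ endsBelow t
  endsBelow-kept {t} ¬e with isEnd? t
  ... | yes e = contradiction e ¬e
  ... | no _  = refl

  endsBelow-noEnds : ∀ {a b} → a ≤ b → (∀ u → a ≤ u → u < b → ¬ IsEnd u) → endsBelow b ≡ endsBelow a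
  endsBelow-noEnds a≤b = go (NP.≤⇒≤′ a≤b)
    where
    go : ∀ {a b} → a ≤′ b → (∀ u → a ≤ u → u < b → ¬ IsEnd u) → endsBelow b ≡ endsBelow a
    go ≤′-refl _ = refl
    go (≤′-step {b} a≤′b) none = trans (endsBelow-kept (none b (NP.≤′⇒≤ a≤′b) (NP.n<1+n b)))
                                       (go a≤′b λ u a≤u u<b → none u a≤u (NP.m<n⇒m<1+n u<b))

  endsBelow-allEnds : ∀ {a b} → a ≤ b → (∀ u → a ≤ u → u < b → IsEnd u) →
                      endsBelow b + a ≡ endsBelow a + b
  endsBelow-allEnds a≤b = go (NP.≤⇒≤′ a≤b)
    where
    go : ∀ {a b} → a ≤′ b → (∀ u → a ≤ u → u < b → IsEnd u) → endsBelow b + a ≡ endsBelow a + b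
    go ≤′-refl _ = refl
    go {a} (≤′-step {b} a≤′b) all = begin
      endsBelow (suc b) + a   ≡⟨ cong (_+ a) (endsBelow-end (all b (NP.≤′⇒≤ a≤′b) (NP.n<1+n b))) ⟩
      suc (endsBelow b + a)   ≡⟨ cong suc (go a≤′b λ u a≤u u<b → all u a≤u (NP.m<n⇒m<1+n u<b)) ⟩
      suc (endsBelow a + b)   ≡˘⟨ NP.+-suc (endsBelow a) b ⟩
      endsBelow a + suc b     ∎

  lastKeptBelow : ∀ {t} T → ¬ IsEnd t → t < T →
                  ∃ λ t₀ → t ≤ t₀ × t₀ < T × ¬ IsEnd t₀ × (∀ u → t₀ < u → u < T → IsEnd u)
  lastKeptBelow (suc T) ¬et t<T with isEnd? T
  ... | no ¬eT = T , NP.m<1+n⇒m≤n t<T , NP.n<1+n T , ¬eT ,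
                 λ u T<u u<1+T → contradiction (NP.m<1+n⇒m≤n u<1+T) (NP.<⇒≱ T<u)
  ... | yes eT with lastKeptBelow T ¬et (NP.≤∧≢⇒< (NP.m<1+n⇒m≤n t<T) λ { refl → ¬et eT })
  ...   | t₀ , t≤t₀ , t₀<T , ¬et₀ , ends = t₀ , t≤t₀ , NP.m<n⇒m<1+n t₀<T , ¬et₀ , ends′
    where
    ends′ : ∀ u → t₀ < u → u < suc T → IsEnd u
    ends′ u t₀<u u<1+T with NP.m<1+n⇒m<n∨m≡n u<1+T
    ... | inj₁ u<T  = ends u t₀<u u<T
    ... | inj₂ refl = eT

  runParity : ∀ {t₀ T} → ¬ IsEnd t₀ → t₀ < T → (∀ u → t₀ < u → u < T → IsEnd u) →
              isOdd t₀ xor isOdd T ≡ true → isOdd (endsBelow T) ≡ isOdd (endsBelow t₀)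
  runParity {t₀} {T} ¬et₀ t₀<T ends odd = begin
    p                            ≡⟨ solve 2 (λ p a → p := (p :+ (con true :+ a)) :+ (con true :+ a)) refl p a ⟩
    (p xor not a) xor not a      ≡⟨ cong (_xor not a) parities ⟩
    (q xor b) xor not a          ≡⟨ solve 3 (λ q a b → (q :+ b) :+ (con true :+ a) := q :+ ((a :+ b) :+ con true))
                                          refl q a b ⟩
    q xor ((a xor b) xor true)   ≡⟨ cong (λ z → q xor (z xor true)) odd ⟩
    q xor false                  ≡⟨ xor-identityʳ q ⟩
    q                            ∎
    where
    p = isOdd (endsBelow T)
    q = isOdd (endsBelow t₀)
    a = isOdd t₀
    b = isOdd T
    counts : endsBelow T + suc t₀ ≡ endsBelow t₀ + T
    counts = trans (endsBelow-allEnds t₀<T ends) (cong (_+ T) (endsBelow-kept ¬et₀))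
    parities : p xor not a ≡ q xor b
    parities = trans (sym (isOdd-+ (endsBelow T) (suc t₀))) (trans (cong isOdd counts) (isOdd-+ (endsBelow t₀) T))

  -- Equivalently: the run of ends strictly between two consecutive kept positions has even length.
  EvenRuns : Set
  EvenRuns = ∀ {t₀ T} → t₀ < T → T < m → ¬ IsEnd t₀ → ¬ IsEnd T →
             (∀ u → t₀ < u → u < T → IsEnd u) → isOdd t₀ xor isOdd T ≡ true

  module _ (evenRuns : EvenRuns) where

    private
      AgreesBelow : ℕ → Set
      AgreesBelow T = T < m → ¬ IsEnd T →
                      ∀ t → t < T → ¬ IsEnd t → isOdd (endsBelow t) ≡ isOdd (endsBelow T)

      agreesBelow : ∀ T → AgreesBelow T
      agreesBelow = <-rec AgreesBelow viaLastKept
        where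
        viaLastKept : ∀ T → (∀ {T′} → T′ < T → AgreesBelow T′) → AgreesBelow T
        viaLastKept T rec T<m ¬eT t t<T ¬et with lastKeptBelow T ¬et t<T
        ... | t₀ , t≤t₀ , t₀<T , ¬et₀ , ends =
          trans untilRun (sym (runParity ¬et₀ t₀<T ends (evenRuns t₀<T T<m ¬et₀ ¬eT ends)))
          where
          untilRun : isOdd (endsBelow t) ≡ isOdd (endsBelow t₀)
          untilRun with NP.m≤n⇒m<n∨m≡n t≤t₀
          ... | inj₁ t<t₀ = rec t₀<T (NP.<-trans t₀<T T<m) ¬et₀ t t<t₀ ¬et
          ... | inj₂ refl = refl

    evenRuns⇒parity-endsBelow : ∀ {t t′} → t < m → t′ < m → ¬ IsEnd t → ¬ IsEnd t′ →
                                isOdd (endsBelow t) ≡ isOdd (endsBelow t′)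
    evenRuns⇒parity-endsBelow {t} {t′} t<m t′<m ¬et ¬et′ with NP.<-cmp t t′
    ... | tri< t<t′ _ _ = agreesBelow t′ t′<m ¬et′ t t<t′ ¬et
    ... | tri≈ _ refl _ = refl
    ... | tri> _ _ t′<t = sym (agreesBelow t t<m ¬et t′ t′<t ¬et′)

StrictlyMonotone : ∀ {m n} → (Fin m → Fin n) → Set
StrictlyMonotone f = f Preserves _<F_ ⟶ _<F_

strictlyMonotone-reflects-< : ∀ {m n} {f : Fin m → Fin n} → StrictlyMonotone f →
                              ∀ {i j} → f i <F f j → i <F j
strictlyMonotone-reflects-< mono {i} {j} fi<fj with FP.<-cmp i j
... | tri< i<j _ _  = i<j
... | tri≈ _ refl _ = contradiction fi<fj (FP.<-irrefl refl)
... | tri> _ _ j<i  = contradiction (mono j<i) (FP.<-asym fi<fj)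

strictlyMonotone-Cyc : ∀ {m n} {f : Fin m → Fin n} → StrictlyMonotone f →
                       ∀ {i j k} → Cyc i j k → Cyc (f i) (f j) (f k)
strictlyMonotone-Cyc mono (inj₁ (i<j , j<k))        = inj₁ (mono i<j , mono j<k)
strictlyMonotone-Cyc mono (inj₂ (inj₁ (j<k , k<i))) = inj₂ (inj₁ (mono j<k , mono k<i))
strictlyMonotone-Cyc mono (inj₂ (inj₂ (k<i , i<j))) = inj₂ (inj₂ (mono k<i , mono i<j))

endsBelow-f : ∀ {m s} {f : Fin s → Fin m} → StrictlyMonotone f →
              ∀ i → EndCount.endsBelow f (toℕ (f i)) ≡ toℕ i
endsBelow-f {s = suc s} {f} mono = <-weakInduction (λ i → endsBelow (toℕ (f i)) ≡ toℕ i) atZero atSuc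
  where
  open EndCount f
  atZero : endsBelow (toℕ (f F.zero)) ≡ 0
  atZero = endsBelow-noEnds z≤n λ u _ u<f0 (j , fj≡u) →
    NP.n≮0 (strictlyMonotone-reflects-< mono (subst (_< toℕ (f F.zero)) (sym fj≡u) u<f0))
  atSuc : ∀ i → endsBelow (toℕ (f (inject₁ i))) ≡ toℕ (inject₁ i) →
          endsBelow (toℕ (f (F.suc i))) ≡ suc (toℕ i)
  atSuc i hyp = begin
    endsBelow (toℕ (f (F.suc i)))           ≡⟨ endsBelow-noEnds (mono (inject₁<suc i)) none ⟩
    endsBelow (suc (toℕ (f (inject₁ i))))   ≡⟨ endsBelow-end (inject₁ i , refl) ⟩
    suc (endsBelow (toℕ (f (inject₁ i))))   ≡⟨ cong suc (trans hyp (FP.toℕ-inject₁ i)) ⟩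
    suc (toℕ i)                             ∎
    where
    none : ∀ u → suc (toℕ (f (inject₁ i))) ≤ u → u < toℕ (f (F.suc i)) → ¬ IsEnd u
    none u fi<u u<fi⁺ (j , refl) =
      NP.<⇒≱ (strictlyMonotone-reflects-< mono fi<u)
             (subst (toℕ j ≤_) (sym (FP.toℕ-inject₁ i))
                    (NP.m<1+n⇒m≤n (strictlyMonotone-reflects-< mono u<fi⁺)))

-- f lists the inner ends of the spokes of an annulus; face i, between spokes i and i+1, is Long
-- when its inner arc has more than one edge.
module LongFaces {m s : ℕ} {f : Fin s → Fin m} (f-mono : StrictlyMonotone f) where
  open EndCount f

  Long : Fin s → Set
  Long i = f (shift i 1) ≢ shift (f i) 1

  after : Fin s → ℕ
  after i = toℕ (shift (f i) 1)

  long⇒¬IsEnd-after : 2 ≤ m → ∀ {i} → Long i → ¬ IsEnd (after i)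
  long⇒¬IsEnd-after m≥2 {i} long (j , fj≡after) =
    long (successor-preserved f (strictlyMonotone-Cyc f-mono) fj≡fi⁺
            λ fj≡fi → shift1≢ m≥2 (f i) (trans (sym fj≡fi⁺) fj≡fi))
    where
    fj≡fi⁺ : f j ≡ shift (f i) 1
    fj≡fi⁺ = FP.toℕ-injective fj≡after

  parity-endsBelow-after : isOdd s ≡ false → ∀ i → isOdd (endsBelow (after i)) ≡ not (isOdd (toℕ i))
  parity-endsBelow-after s-even i with shift1-cases (f i)
  ... | inj₁ (_ , after≡) = cong isOdd (begin
    endsBelow (after i)             ≡⟨ cong endsBelow after≡ ⟩
    endsBelow (suc (toℕ (f i)))     ≡⟨ endsBelow-end (i , refl) ⟩
    suc (endsBelow (toℕ (f i)))     ≡⟨ cong suc (endsBelow-f f-mono i) ⟩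
    suc (toℕ i)                     ∎)
  ... | inj₂ (fi-last , after≡0) with shift1-cases i
  ...   | inj₁ (_ , i⁺≡) = contradiction (FP.toℕ<n (f (shift i 1)))
                                          (NP.≤⇒≯ (subst (_≤ toℕ (f (shift i 1))) fi-last (f-mono i<i⁺)))
    where
    i<i⁺ : i <F shift i 1
    i<i⁺ = subst (toℕ i <_) (sym i⁺≡) (NP.n<1+n (toℕ i))
  ...   | inj₂ (i-last , _) = trans (cong (isOdd ∘ endsBelow) after≡0) (sym (trans (cong isOdd i-last) s-even))

  longFaces-sameParity : 2 ≤ m → isOdd s ≡ false → EvenRuns →
                         ∀ {i i′} → Long i → Long i′ → isOdd (toℕ i) ≡ isOdd (toℕ i′)
  longFaces-sameParity m≥2 s-even evenRuns {i} {i′} long long′ = not-injective (begin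
    not (isOdd (toℕ i))            ≡˘⟨ parity-endsBelow-after s-even i ⟩
    isOdd (endsBelow (after i))    ≡⟨ evenRuns⇒parity-endsBelow evenRuns (FP.toℕ<n _) (FP.toℕ<n _)
                                        (long⇒¬IsEnd-after m≥2 long) (long⇒¬IsEnd-after m≥2 long′) ⟩
    isOdd (endsBelow (after i′))   ≡⟨ parity-endsBelow-after s-even i′ ⟩
    not (isOdd (toℕ i′))           ∎)

oneParityClassAvoids : ∀ {n p} {P : Fin n → Set p} → Decidable P →
                       (∀ {i j} → P i → P j → isOdd (toℕ i) ≡ isOdd (toℕ j)) →
                       (∀ i → toℕ i % 2 ≡ 0 → ¬ P i) ⊎ (∀ i → toℕ i % 2 ≡ 1 → ¬ P i)
oneParityClassAvoids {P = P} P? sameParity with FP.any? P?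
... | no ¬∃P = inj₁ λ i _ Pi → ¬∃P (i , Pi)
... | yes (i₀ , Pi₀) =
  avoid (isOdd (toℕ i₀)) λ i Pi →
    trans (n%2≡if-isOdd (toℕ i)) (cong (λ b → if b then 1 else 0) (sameParity Pi Pi₀))
  where
  avoid : ∀ b → (∀ i → P i → toℕ i % 2 ≡ (if b then 1 else 0)) →
          (∀ i → toℕ i % 2 ≡ 0 → ¬ P i) ⊎ (∀ i → toℕ i % 2 ≡ 1 → ¬ P i)
  avoid true  inClass₁ = inj₁ λ i i%2≡0 Pi → NP.0≢1+n (trans (sym i%2≡0) (inClass₁ i Pi))
  avoid false inClass₀ = inj₂ λ i i%2≡1 Pi → NP.1+n≢0 (trans (sym i%2≡1) (inClass₀ i Pi))

module SpokeEnds {x : ℕ} (D : ADB x) where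
  open ADB D
  open ADBGraph D

  SpokeEnd : Vtx → Set
  SpokeEnd v = ∃ λ a → ∃ λ i → (inject₁ a , sin a i) ≡ v ⊎ (F.suc a , sout a i) ≡ v

  spokeEnd? : Decidable SpokeEnd
  spokeEnd? v = FP.any? λ a → FP.any? λ i → Vtx-≟ _ v ⊎-dec Vtx-≟ _ v
    where Vtx-≟ = ≡-dec FP._≟_ FP._≟_

  -- A vertex on no spoke meets only the two cycle edges around it, one at each kind of end.
  private
    side : ∀ {v} → Incident graph v → Fin 2
    side (inj₁ _) = F.zero
    side (inj₂ _) = F.suc F.zero

    side-injective : ∀ {v} → ¬ SpokeEnd v → Injective _≡_ _≡_ (side {v})
    side-injective ¬sp {inj₁ (spk a i , e)} _ = contradiction (a , i , inj₁ e) ¬sp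
    side-injective ¬sp {inj₁ (cyc _ _ , _)} {inj₁ (spk a i , e)} _ = contradiction (a , i , inj₁ e) ¬sp
    side-injective ¬sp {inj₁ (cyc k j , refl)} {inj₁ (cyc .k .j , refl)} _ = refl
    side-injective ¬sp {inj₂ (spk a i , e)} _ = contradiction (a , i , inj₂ e) ¬sp
    side-injective ¬sp {inj₂ (cyc _ _ , _)} {inj₂ (spk a i , e)} _ = contradiction (a , i , inj₂ e) ¬sp
    side-injective ¬sp {inj₂ (cyc k j , refl)} {inj₂ (cyc k′ j′ , e)} _ with cong proj₁ e
    ... | refl with shift1-injective (,-injectiveʳ e)
    ...   | refl with e
    ...     | refl = refl

  cubic⇒spokeEnd : Cubic graph → ∀ v → SpokeEnd v
  cubic⇒spokeEnd cubic v with spokeEnd? v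
  ... | yes sp = sp
  ... | no ¬sp = ⊥-elim (FP.<⇒notInjective (NP.n<1+n 2)
                           (Injection.injective (↔⇒↣ (↔-sym (cubic v))) ∘ side-injective ¬sp))

-- With x = 2 + w: a is the outer annulus O_G = A_x and b is A_{x-1}; below, inner and outer are
-- the cycles C_{x-2}, C_{x-1} and C_x.
module OuterAnnulus {w : ℕ} (D : ADB (2 + w)) (cubic : Cubic (ADBGraph.graph D))
                    (g : ADBGraph.Vtx D → Bool)
                    (g-proper : ∀ e → g (proj₁ (ADBGraph.edEnds D e)) ≢ g (proj₂ (ADBGraph.edEnds D e))) where
  open ADB D
  open ADBGraph D
  open SpokeEnds D

  a b : Fin (2 + w)
  a = fromℕ (1 + w)
  b = inject₁ (fromℕ w)

  below inner outer : Fin (3 + w)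
  below = inject₁ b
  inner = inject₁ a
  outer = F.suc a

  len≥2 : ∀ k → 2 ≤ len k
  len≥2 k = NP.≤-trans (NP.n≤1+n 2) (len≥3 k)

  vertex-injective : ∀ {k} {j j′ : Fin (len k)} → _≡_ {A = Vtx} (k , j) (k , j′) → j ≡ j′
  vertex-injective = ,-injectiveʳ

  outerVertex-spoke : ∀ j → ∃ λ i → sout a i ≡ j
  outerVertex-spoke j with cubic⇒spokeEnd cubic (outer , j)
  ... | a′ , i , inj₁ e = contradiction (sym (cong proj₁ e)) FP.fromℕ≢inject₁
  ... | a′ , i , inj₂ e with FP.suc-injective (cong proj₁ e)
  ...   | refl = i , vertex-injective e

  sout-shift : ∀ i → sout a (shift i 1) ≡ shift (sout a i) 1
  sout-shift i = successor-preserved (sout a) (λ {i} {j} {k} → noncross a i j k) hit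
                   λ e → shift1≢ (len≥2 outer) (sout a i) (trans (sym hit) e)
    where hit = proj₂ (outerVertex-spoke (shift (sout a i) 1))

  open LongFaces {f = sin a} (λ {i} {j} → sin-mono a i j)

  short⇒faceLength≡4 : ∀ i → ¬ Long i → faceLength a i ≡ 4
  short⇒faceLength≡4 i ¬long
    rewrite decidable-stable (sin a (shift i 1) FP.≟ shift (sin a i) 1) ¬long
          | cdist-shift1 (len≥2 inner) (sin a i)
          | sout-shift i
          | cdist-shift1 (len≥2 outer) (sout a i) = refl

  shortClass⇒fourCycles : ∀ {r} → (∀ i → toℕ i % 2 ≡ r → ¬ Long i) → ClassAllFourCycles a r
  shortClass⇒fourCycles short i inClass = short⇒faceLength≡4 i (short i inClass)

  nsp-even : isOdd (nsp a) ≡ false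
  nsp-even = alternating⇒even {h = λ i → g (inner , sin a i)} λ i same →
    g-proper (spk a (shift i 1)) (trans same (trans
      (≢-≢⇒≡ (g-proper (spk a i)) (g-proper (cyc outer (sout a i))))
      (cong (λ j → g (outer , j)) (sym (sout-shift i)))))

  outerEnd : ∀ j → T (isOuterEnd a (outer , j))
  outerEnd j with F.suc a FP.≟ F.suc a
  ... | yes refl = anyB-intro (proj₁ (outerVertex-spoke j)) (fromWitness (proj₂ (outerVertex-spoke j)))
  ... | no a≢a   = contradiction refl a≢a

  ¬outerBarnette : ¬ OuterBarnette a
  ¬outerBarnette (_ , notCurve) =
    T-not⇒¬T notCurve (allB-intro λ j → T-not-∧-not (suc (toℕ a) ≤ᵇ toℕ outer) (outerEnd j))

  innerBarnette : AnnularConnected → InnerBarnette a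
  innerBarnette ac with ac a
  ... | inj₁ (_ , ob)        = contradiction ob ¬outerBarnette
  ... | inj₂ (inj₁ (ib , _)) = ib
  ... | inj₂ (inj₂ (_ , ob)) = contradiction ob ¬outerBarnette

  -- Stated outside InnerPiece, where this with-abstraction would be ill-typed (the type of the
  -- piece colouring mentions the same test).
  innerEnd≡ : ∀ j → isInnerEnd a (inner , j) ≡ anyB (λ i → ⌊ sin a i FP.≟ j ⌋)
  innerEnd≡ j with inject₁ a FP.≟ inject₁ a
  ... | yes refl = refl
  ... | no a≢a   = contradiction refl a≢a

  module InnerPiece (bipartite : Bipartite (Piece.piece inner (keptIn a))) where
    open Piece inner (keptIn a)
    open EndCount (sin a)

    kept : Vtx → Bool
    kept = keptIn a

    colour : ∀ v → T (kept v) → Bool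
    colour v t = proj₁ bipartite (v , t)

    colour-irrelevant : ∀ v {t t′} → colour v t ≡ colour v t′
    colour-irrelevant v = cong (colour v) (T-irrelevant _ _)

    colour-edge : ∀ e → T (keepEd e) → ∀ tu tw →
                  colour (proj₁ (edEnds e)) tu ≢ colour (proj₂ (edEnds e)) tw
    colour-edge e k _ _ = subst₂ _≢_ (colour-irrelevant _) (colour-irrelevant _) (proj₂ bipartite (inj₁ (e , k)))

    colour-segment : ∀ {j j′} → T (segOK j j′) → ∀ t t′ → colour (inner , j) t ≢ colour (inner , j′) t′
    colour-segment {j} {j′} k _ _ =
      subst₂ _≢_ (colour-irrelevant _) (colour-irrelevant _) (proj₂ bipartite (inj₂ ((j , j′) , k)))

    colour⊕g : ∀ v → T (kept v) → Bool
    colour⊕g v t = colour v t xor g v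

    colour⊕g-edge : ∀ e → T (keepEd e) → ∀ tu tw →
                    colour⊕g (proj₁ (edEnds e)) tu ≡ colour⊕g (proj₂ (edEnds e)) tw
    colour⊕g-edge e k tu tw = ≢-xor-≢ (colour-edge e k tu tw) (g-proper e)

    below≢inner : below ≢ inner
    below≢inner = FP.fromℕ≢inject₁ ∘ sym ∘ FP.inject₁-injective

    kept-below : ∀ j → T (kept (below , j))
    kept-below j with below FP.≟ inject₁ a
    ... | yes below≡inner = contradiction below≡inner below≢inner
    ... | no _ = Equivalence.from T-∧ (NP.≤⇒≤ᵇ below≤a , tt)
      where
      below≤a : toℕ below ≤ toℕ a
      below≤a = subst₂ _≤_ (sym (trans (FP.toℕ-inject₁ b)
                                       (trans (FP.toℕ-inject₁ (fromℕ w)) (FP.toℕ-fromℕ w))))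
                           (sym (FP.toℕ-fromℕ (suc w))) (NP.n≤1+n w)

    innerEnd⇔ : ∀ j → T (isInnerEnd a (inner , j)) ⇔ IsEnd (toℕ j)
    innerEnd⇔ j rewrite innerEnd≡ j =
      mk⇔ (λ t → let i , tᵢ = anyB-elim t in i , cong toℕ (toWitness tᵢ))
          (λ (i , e) → anyB-intro i (fromWitness (FP.toℕ-injective e)))

    kept-inner⇔ : ∀ j → T (kept (inner , j)) ⇔ (¬ IsEnd (toℕ j))
    kept-inner⇔ j =
      mk⇔ (λ t → T-not⇒¬T (proj₂ (Equivalence.to T-∧ t)) ∘ Equivalence.from (innerEnd⇔ j))
          (λ ¬e → Equivalence.from T-∧ ( NP.≤⇒≤ᵇ inner≤a
                                       , ¬T⇒T-not (¬e ∘ Equivalence.to (innerEnd⇔ j))))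
      where
      inner≤a : toℕ inner ≤ toℕ a
      inner≤a = NP.≤-reflexive (FP.toℕ-inject₁ a)

    colour⊕g-below : ∀ j j′ → colour⊕g (below , j) (kept-below j) ≡ colour⊕g (below , j′) (kept-below j′)
    colour⊕g-below j j′ =
      xor-exchange (colour (below , j) (kept-below j)) (colour (below , j′) (kept-below j′))
                   (g (below , j)) (g (below , j′))
        (trans (alternating⇒xor≡isOdd colour-alt j j′) (sym (alternating⇒xor≡isOdd g-alt j j′)))
      where
      edge-kept : ∀ j → T (keepEd (cyc below j))
      edge-kept j = Equivalence.from T-∧ ( fromWitnessFalse {a? = below FP.≟ inner} below≢inner
                                         , Equivalence.from T-∧ (kept-below j , kept-below (shift j 1)))
      colour-alt : Alternating λ j → colour (below , j) (kept-below j)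
      colour-alt j = colour-edge (cyc below j) (edge-kept j) _ _ ∘ sym
      g-alt : Alternating λ j → g (below , j)
      g-alt j = g-proper (cyc below j) ∘ sym

    colour⊕g-inner-below : ∀ j (t : T (kept (inner , j))) →
                           ∃ λ p → colour⊕g (inner , j) t ≡ colour⊕g (below , p) (kept-below p)
    colour⊕g-inner-below j t with cubic⇒spokeEnd cubic (inner , j)
    ... | a′ , i , inj₁ e with FP.inject₁-injective (cong proj₁ e)
    ...   | refl = contradiction (i , cong toℕ (vertex-injective e)) (Equivalence.to (kept-inner⇔ j) t)
    colour⊕g-inner-below j t | a′ , i , inj₂ e with FP.suc-injective (cong proj₁ e)
    ...   | refl with vertex-injective e
    ...     | refl = sin b i , sym (colour⊕g-edge (spk b i) spoke-kept (kept-below (sin b i)) t)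
      where
      spoke-kept : T (keepEd (spk b i))
      spoke-kept = Equivalence.from T-∧ (tt , Equivalence.from T-∧ (kept-below (sin b i) , t))

    colour⊕g-inner : ∀ j j′ t t′ → colour⊕g (inner , j) t ≡ colour⊕g (inner , j′) t′
    colour⊕g-inner j j′ t t′ with colour⊕g-inner-below j t | colour⊕g-inner-below j′ t′
    ... | p , j~p | p′ , j′~p′ = trans j~p (trans (colour⊕g-below p p′) (sym j′~p′))

    colour-inner-parity : ∀ j j′ t t′ →
                          colour (inner , j) t xor colour (inner , j′) t′ ≡ isOdd (toℕ j) xor isOdd (toℕ j′)
    colour-inner-parity j j′ t t′ = trans
      (xor-exchange (colour (inner , j) t) (g (inner , j)) (colour (inner , j′) t′) (g (inner , j′))
                    (colour⊕g-inner j j′ t t′))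
      (alternating⇒xor≡isOdd (λ j → g-proper (cyc inner j) ∘ sym) j j′)

    consecutiveKept⇒segOK : ∀ {j₀ j₁} → j₀ <F j₁ → T (kept (inner , j₀)) → T (kept (inner , j₁)) →
                            (∀ u → toℕ j₀ < u → u < toℕ j₁ → IsEnd u) → T (segOK j₀ j₁)
    consecutiveKept⇒segOK {j₀} {j₁} j₀<j₁ k₀ k₁ ends =
      Equivalence.from T-∧ (k₀ , Equivalence.from T-∧ (k₁ , allB-intro {len inner} between))
      where
      between : ∀ t → T (not ((1 ≤ᵇ toℕ t) ∧ (toℕ t <ᵇ cdist j₀ j₁)) ∨
                         not (kept (inner , shift j₀ (toℕ t))))
      between t with (1 ≤ᵇ toℕ t) ∧ (toℕ t <ᵇ cdist j₀ j₁) in inRange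
      ... | false = tt
      ... | true  = ¬T⇒T-not λ k → Equivalence.to (kept-inner⇔ _) k (subst IsEnd (sym position) (ends _ lo hi))
        where
        bounds = Equivalence.to T-∧ (Equivalence.from T-≡ inRange)
        t<gap : toℕ t < toℕ j₁ ∸ toℕ j₀
        t<gap = subst (toℕ t <_) (cdist-< j₀ j₁ j₀<j₁) (NP.<ᵇ⇒< (toℕ t) _ (proj₂ bounds))
        lo : toℕ j₀ < toℕ j₀ + toℕ t
        lo = NP.m<m+n (toℕ j₀) (NP.≤ᵇ⇒≤ 1 (toℕ t) (proj₁ bounds))
        hi : toℕ j₀ + toℕ t < toℕ j₁
        hi = subst (toℕ j₀ + toℕ t <_) (NP.m+[n∸m]≡n (NP.<⇒≤ j₀<j₁)) (NP.+-monoʳ-< (toℕ j₀) t<gap)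
        position : toℕ (shift j₀ (toℕ t)) ≡ toℕ j₀ + toℕ t
        position = toℕ-shift j₀ (toℕ t) (NP.<-trans hi (FP.toℕ<n j₁))

    evenRuns : EvenRuns
    evenRuns {t₀} {t₁} t₀<t₁ t₁<m ¬e₀ ¬e₁ ends = begin
      isOdd t₀ xor isOdd t₁                               ≡˘⟨ cong₂ (λ p q → isOdd p xor isOdd q)
                                                                    toℕ-j₀ toℕ-j₁ ⟩
      isOdd (toℕ j₀) xor isOdd (toℕ j₁)                   ≡˘⟨ colour-inner-parity j₀ j₁ k₀ k₁ ⟩
      colour (inner , j₀) k₀ xor colour (inner , j₁) k₁   ≡⟨ ≢⇒xor≡true (colour-segment segment k₀ k₁) ⟩
      true                                                ∎
      where
      j₀ = fromℕ< (NP.<-trans t₀<t₁ t₁<m)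
      j₁ = fromℕ< t₁<m
      toℕ-j₀ = FP.toℕ-fromℕ< (NP.<-trans t₀<t₁ t₁<m)
      toℕ-j₁ = FP.toℕ-fromℕ< t₁<m
      k₀ = Equivalence.from (kept-inner⇔ j₀) (subst (¬_ ∘ IsEnd) (sym toℕ-j₀) ¬e₀)
      k₁ = Equivalence.from (kept-inner⇔ j₁) (subst (¬_ ∘ IsEnd) (sym toℕ-j₁) ¬e₁)
      segment : T (segOK j₀ j₁)
      segment = consecutiveKept⇒segOK (subst₂ _<_ (sym toℕ-j₀) (sym toℕ-j₁) t₀<t₁) k₀ k₁
                  (subst₂ (λ p q → ∀ u → p < u → u < q → IsEnd u) (sym toℕ-j₀) (sym toℕ-j₁) ends)

    fourCycleClass : ClassAllFourCycles a 0 ⊎ ClassAllFourCycles a 1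
    fourCycleClass =
      Sum.map shortClass⇒fourCycles shortClass⇒fourCycles
        (oneParityClassAvoids (λ i → ¬? (sin a (shift i 1) FP.≟ shift (sin a i) 1))
                              (longFaces-sameParity (len≥2 inner) nsp-even evenRuns))

lemma3p3 : (x : ℕ) (D : ADB x) (h : 3 ≤ x) → ADBGraph.IsADBAC D →
    ADBGraph.ClassAllFourCycles D (outerAnnulus h) 0 ⊎
    ADBGraph.ClassAllFourCycles D (outerAnnulus h) 1
lemma3p3 (suc (suc (suc w))) D (s≤s (s≤s (s≤s _))) (_ , (_ , cubic , _ , g , g-proper) , ac) =
  InnerPiece.fourCycleClass innerBipartite
  where
  open OuterAnnulus {suc w} D cubic g g-proper
  innerBipartite = proj₂ (proj₂ (proj₂ (proj₁ (innerBarnette ac))))
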